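{- Let $i\ge 2$, let $\rho$ be an acceptable complexity measure builder with witness $\hat\rho_i$, and let $\alpha,\beta\in\mathbb Q$ with $\alpha>0$. Then the builder with witness $\alpha\cdot\hat\rho_i+\beta$ (which associates to each $g\in G$ the function $\alpha\cdot\rho_g+\beta$) is also acceptable; i.e. for every $g\in G$, $\alpha\cdot\rho_g+\beta$ is an acceptable complexity measure.
   Context: $X_i$ is a fixed alphabet with $i\ge 2$ letters, $X_i^*$ the set of finite strings over it, $|u|_i$ the length of $u$; $X_2^*$ is the set of binary strings. $H_2(y)$ denotes the prefix-free program-size complexity of $y\in X_2^*$: the length of a shortest binary input on which a fixed universal self-delimiting (prefix-free domain) Turing machine $U_2$ outputs $y$. $G$ is the set of Gödel numberings, i.e. computable one-to-one functions $g:X_i^*\to X_2^*$. Given a computable function $\hat\rho_i:\mathbb N\times\mathbb N\to\mathbb Q$ (the witness), the complexity measure builder $\rho$ associates to each $g\in G$ the function $\rho_g:X_i^*\to\mathbb Q$, $\rho_g(u)=\hat\rho_i(H_2(g(u)),|u|_i)$. The builder $\rho$ is acceptable if for every $g\in G$: (i) for every finitely-specified (computably enumerable axioms), sound, consistent theory $\mathcal F$ strong enough to formalize arithmetic, whose sentences are written as strings in $X_i^*$, there exists an integer $N_{\mathcal F}$ such that $\mathcal F\vdash x$ implies $\rho_g(x)<N_{\mathcal F}$; (ii) for every integer $N$, $\lim_{n\to\infty} i^{ -n}\cdot\operatorname{card}\{x\in X_i^*: |x|_i=n,\ \rho_g(x)\le N\}=0$; (iii) for every $g'\in G$ there is a constant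 $c$ with $|\rho_g(u)-\rho_{g'}(u)|\le c$ for all $u\in X_i^*$. An acceptable complexity measure is a function $\rho_g$ with $\rho$ an acceptable builder and $g\in G$. -}

module Defs where

open import Level using (Level; 0ℓ) renaming (suc to lsuc)
open import Data.Nat using (ℕ; zero; suc; _^_; _≥_; _≤_)
open import Data.Integer using (ℤ; +_)
open import Data.Rational using (ℚ; 0ℚ; _/_; _+_; _*_; _-_; ∣_∣; _<_; _≤ᵇ_) renaming (_≤_ to _≤ℚ_)
open import Data.Fin using (Fin)
open import Data.List using (List; []; _∷_; length; map; concatMap; filterᵇ; allFin)
open import Data.Bool using (Bool)
open import Data.Product using (Σ; ∃; _×_)

ℕ→ℚ : ℕ → ℚ
ℕ→ℚ n = (+ n) / 1

ℤ→ℚ : ℤ → ℚ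
ℤ→ℚ z = z / 1

-- The data of the paper that cannot be constructed inside Agda
-- (uncomputable H₂, the class G of Gödel numberings, the class of
-- finitely-specified sound consistent arithmetic theories with sentences
-- in X_i^*) is taken as an abstract, arbitrary setting.
record Setting : Set₁ where
  field
    i          : ℕ
    two≤i      : 2 ≤ i
    -- prefix-free program-size complexity H₂ on binary strings
    H₂         : List Bool → ℕ
    IsGödel    : (List (Fin i) → List Bool) → Set
    Theory     : Set
    _⊢_        : Theory → List (Fin i) → Set

module _ (S : Setting) where
  open Setting S

  Word : Set
  Word = List (Fin i)

  -- a witness is a (computable, i.e. Agda-definable) function ℕ × ℕ → ℚ
  Witness : Set
  Witness = ℕ → ℕ → ℚ

  ρ[_]_ : Witness → (Word → List Bool) → Word → ℚ
  ρ[ ρ̂ ] g = λ u → ρ̂ (H₂ (g u)) (length u)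

  wordsOfLength : ℕ → List Word
  wordsOfLength zero    = [] ∷ []
  wordsOfLength (suc n) = concatMap (λ w → map (Data.List._∷ w) (allFin i)) (wordsOfLength n)

  countLe : (Word → ℚ) → ℤ → ℕ → ℕ
  countLe f N n = length (filterᵇ (λ x → f x ≤ᵇ ℤ→ℚ N) (wordsOfLength n))

  Cond-i : (Word → ℚ) → Set
  Cond-i f = (F : Theory) → Σ ℤ λ N → ∀ x → F ⊢ x → f x < ℤ→ℚ N

  -- condition (ii): lim_{n→∞} i^{-n} · card{...} = 0, written as
  -- ∀ ε > 0, ∃ n₀, ∀ n ≥ n₀, card{...} < ε · i^n
  Cond-ii : (Word → ℚ) → Set
  Cond-ii f = (N : ℤ) → (ε : ℚ) → 0ℚ < ε →
    Σ ℕ λ n₀ → ∀ n → n ≥ n₀ → ℕ→ℚ (countLe f N n) < ε * ℕ→ℚ (i ^ n)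

  Cond-iii : (Word → ℚ) → (Word → ℚ) → Set
  Cond-iii f f' = Σ ℚ λ c → ∀ u → ∣ f u - f' u ∣ ≤ℚ c

  Acceptable : Witness → Set
  Acceptable ρ̂ = (g : Word → List Bool) → IsGödel g →
      Cond-i (ρ[ ρ̂ ] g)
    × Cond-ii (ρ[ ρ̂ ] g)
    × ((g' : Word → List Bool) → IsGödel g' → Cond-iii (ρ[ ρ̂ ] g) (ρ[ ρ̂ ] g'))

affineWitness : ℚ → ℚ → (ℕ → ℕ → ℚ) → (ℕ → ℕ → ℚ)
affineWitness α β ρ̂ a b = (α * ρ̂ a b) + β

-- An acceptable builder only ever uses ρ_g through three properties: the
-- values on theorems are bounded, every sublevel set {ρ_g ≤ N} is
-- asymptotically negligible, and changing the Gödel numbering moves ρ_g by a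
-- bounded amount.  Each is preserved by post-composition with a map φ : ℚ → ℚ
-- that is strictly increasing, has sublevel sets bounded above, and is
-- Lipschitz, respectively; x ↦ α x + β with α > 0 is all three.
module Submission where

open import Defs
open import Data.Nat using (ℕ)
open import Data.Rational using (ℚ; _<_; 0ℚ)

import Data.Nat as ℕ
import Data.Integer as ℤ
import Data.Integer.Properties as ℤ
open import Data.Nat.Coprimality using (1-coprimeTo) renaming (sym to coprime-sym)
open import Data.Integer using (ℤ; +_; -[1+_]; ∣_∣)
open import Data.Rational
  using (mkℚ; 1ℚ; *≤*; _+_; _*_; _-_; -_; 1/_; Positive; NonNegative; positive)
  renaming (_≤_ to _≤ℚ_; ∣_∣ to ∣_∣ℚ)
open import Data.Rational.Properties
open import Data.List using (length; filterᵇ)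
open import Data.List.Relation.Binary.Sublist.Propositional using (⊆-refl)
open import Data.List.Relation.Binary.Sublist.Heterogeneous.Properties
  using (length-mono-≤; ⊆-filter-Sublist)
open import Data.Bool using (Bool; T)
open import Data.Bool.Properties using (T?)
open import Data.Product using (∃; _,_)
open import Function using (_∘_)
open import Relation.Binary.Core using (_Preserves_⟶_)
open import Relation.Binary.PropositionalEquality
import Algebra.Properties.Group as GroupProperties

open GroupProperties +-0-group using (//-rightDividesʳ)

length-filterᵇ-mono : ∀ {A : Set} (p q : A → Bool) → (∀ x → T (p x) → T (q x)) →
  ∀ xs → length (filterᵇ p xs) ℕ.≤ length (filterᵇ q xs)
length-filterᵇ-mono p q p⇒q xs =
  length-mono-≤ (⊆-filter-Sublist (T? ∘ p) (T? ∘ q) (λ { refl → p⇒q _ }) (⊆-refl {x = xs}))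

ℤ→ℚ≡mkℚ : ∀ z → ℤ→ℚ z ≡ mkℚ z 0 (coprime-sym (1-coprimeTo ∣ z ∣))
ℤ→ℚ≡mkℚ (+ n)    = normalize-coprime (coprime-sym (1-coprimeTo n))
ℤ→ℚ≡mkℚ -[1+ n ] = cong -_ (normalize-coprime (coprime-sym (1-coprimeTo (ℕ.suc n))))

ℤ→ℚ-mono-≤ : ∀ {m n} → m ℤ.≤ n → ℤ→ℚ m ≤ℚ ℤ→ℚ n
ℤ→ℚ-mono-≤ {m} {n} m≤n rewrite ℤ→ℚ≡mkℚ m | ℤ→ℚ≡mkℚ n =
  *≤* (subst₂ ℤ._≤_ (sym (ℤ.*-identityʳ m)) (sym (ℤ.*-identityʳ n)) m≤n)

ℕ→ℚ-mono-≤ : ∀ {m n} → m ℕ.≤ n → ℕ→ℚ m ≤ℚ ℕ→ℚ n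
ℕ→ℚ-mono-≤ = ℤ→ℚ-mono-≤ ∘ ℤ.+≤+

-- The bound is the numerator's absolute value, as the denominator is ≥ 1.
ℤ→ℚ-upperBound : ∀ q → ∃ λ M → q ≤ℚ ℤ→ℚ M
ℤ→ℚ-upperBound q@(mkℚ n d _) =
  + ∣ n ∣ , subst (q ≤ℚ_) (sym (ℤ→ℚ≡mkℚ (+ ∣ n ∣))) (*≤* (num≤ n))
  where
  num≤ : ∀ n → n ℤ.* + 1 ℤ.≤ + ∣ n ∣ ℤ.* + ℕ.suc d
  num≤ (+ k)    = ℤ.*-monoˡ-≤-nonNeg (+ k) (ℤ.+≤+ (ℕ.s≤s ℕ.z≤n))
  num≤ -[1+ k ] rewrite ℤ.*-identityʳ -[1+ k ] = ℤ.-≤+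

BoundedSublevels : (ℚ → ℚ) → Set
BoundedSublevels φ = ∀ c → ∃ λ b → ∀ y → φ y ≤ℚ c → y ≤ℚ b

Lipschitz : ℚ → (ℚ → ℚ) → Set
Lipschitz L φ = ∀ x y → ∣ φ x - φ y ∣ℚ ≤ℚ L * ∣ x - y ∣ℚ

module _ (S : Setting) where
  countLe-mono : ∀ {f f' : Word S → ℚ} N N' →
    (∀ x → f x ≤ℚ ℤ→ℚ N → f' x ≤ℚ ℤ→ℚ N') → ∀ n → countLe S f N n ℕ.≤ countLe S f' N' n
  countLe-mono N N' sub n = length-filterᵇ-mono _ _
    (λ x le → ≤⇒≤ᵇ (sub x (≤ᵇ⇒≤ le))) (wordsOfLength S n)

  Cond-i-∘ : ∀ {φ f} → φ Preserves _<_ ⟶ _<_ → Cond-i S f → Cond-i S (φ ∘ f)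
  Cond-i-∘ {φ} φ-mono bounded F =
    let N , theorems<N = bounded F
        M , φN≤M       = ℤ→ℚ-upperBound (φ (ℤ→ℚ N))
    in M , λ x F⊢x → <-≤-trans (φ-mono (theorems<N x F⊢x)) φN≤M

  Cond-ii-∘ : ∀ {φ f} → BoundedSublevels φ → Cond-ii S f → Cond-ii S (φ ∘ f)
  Cond-ii-∘ {φ} {f} sublevels sparse N ε ε>0 =
    let b , below-b = sublevels (ℤ→ℚ N)
        M , b≤M     = ℤ→ℚ-upperBound b
        n₀ , few    = sparse M ε ε>0
        fewer : ∀ n → countLe S (φ ∘ f) N n ℕ.≤ countLe S f M n
        fewer = countLe-mono N M (λ x φfx≤N → ≤-trans (below-b _ φfx≤N) b≤M)
    in n₀ , λ n n≥n₀ → ≤-<-trans (ℕ→ℚ-mono-≤ (fewer n)) (few n n≥n₀)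

  Cond-iii-∘ : ∀ {φ f f'} L .{{_ : NonNegative L}} → Lipschitz L φ →
    Cond-iii S f f' → Cond-iii S (φ ∘ f) (φ ∘ f')
  Cond-iii-∘ L lipschitz (c , close) =
    L * c , λ u → ≤-trans (lipschitz _ _) (*-monoˡ-≤-nonNeg L (close u))

  Acceptable-∘ : ∀ {φ} L .{{_ : NonNegative L}} →
    φ Preserves _<_ ⟶ _<_ → BoundedSublevels φ → Lipschitz L φ →
    ∀ ρ̂ → Acceptable S ρ̂ → Acceptable S (λ h n → φ (ρ̂ h n))
  Acceptable-∘ {φ} L φ-mono sublevels lipschitz ρ̂ acc g gödel =
    let bounded , sparse , stable = acc g gödel in
    Cond-i-∘ φ-mono bounded ,
    Cond-ii-∘ sublevels sparse ,
    λ g' gödel' → Cond-iii-∘ {φ} L lipschitz (stable g' gödel')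

affine : ℚ → ℚ → ℚ → ℚ
affine α β x = α * x + β

module _ (α β : ℚ) .{{_ : Positive α}} where

  affine-mono-< : affine α β Preserves _<_ ⟶ _<_
  affine-mono-< x<y = +-monoˡ-< β (*-monoʳ-<-pos α x<y)

  affine-boundedSublevels : BoundedSublevels (affine α β)
  affine-boundedSublevels c = (c - β) * 1/ α , λ y αy+β≤c →
    *-cancelˡ-≤-pos α (subst₂ _≤ℚ_ (//-rightDividesʳ β (α * y)) (sym (α*[x*1/α]≡x (c - β)))
                                    (+-monoˡ-≤ (- β) αy+β≤c))
    where
    instance
      α≢0 = pos⇒nonZero α
    α*[x*1/α]≡x : ∀ x → α * (x * 1/ α) ≡ x
    α*[x*1/α]≡x x = begin
      α * (x * 1/ α) ≡⟨ cong (α *_) (*-comm x (1/ α)) ⟩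
      α * (1/ α * x) ≡⟨ *-assoc α (1/ α) x ⟨
      α * 1/ α * x   ≡⟨ cong (_* x) (*-inverseʳ α) ⟩
      1ℚ * x         ≡⟨ *-identityˡ x ⟩
      x              ∎
      where open ≡-Reasoning

  affine-lipschitz : Lipschitz α (affine α β)
  affine-lipschitz x y = ≤-reflexive (begin
    ∣ (α * x + β) - (α * y + β) ∣ℚ ≡⟨ cong ∣_∣ℚ (affine-diff x y) ⟩
    ∣ α * (x - y) ∣ℚ              ≡⟨ ∣p*q∣≡∣p∣*∣q∣ α (x - y) ⟩
    ∣ α ∣ℚ * ∣ x - y ∣ℚ           ≡⟨ cong (_* ∣ x - y ∣ℚ) (0≤p⇒∣p∣≡p (<⇒≤ (positive⁻¹ α))) ⟩
    α * ∣ x - y ∣ℚ                ∎)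
    where
    open ≡-Reasoning
    affine-diff : ∀ x y → (α * x + β) - (α * y + β) ≡ α * (x - y)
    affine-diff x y = begin
      (α * x + β) - (α * y + β)     ≡⟨ cong (_+_ (α * x + β)) (neg-distrib-+ (α * y) β) ⟩
      (α * x + β) + (- (α * y) - β) ≡⟨ cong (_+_ (α * x + β)) (+-comm (- (α * y)) (- β)) ⟩
      (α * x + β) + (- β - α * y)   ≡⟨ +-assoc (α * x + β) (- β) (- (α * y)) ⟨
      (α * x + β) - β - α * y       ≡⟨ cong (_- α * y) (//-rightDividesʳ β (α * x)) ⟩
      α * x - α * y                 ≡⟨ cong (_+_ (α * x)) (neg-distribʳ-* α y) ⟩
      α * x + α * - y               ≡⟨ *-distribˡ-+ α x (- y) ⟨
      α * (x - y)                   ∎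

proposition6p1 : (S : Setting) → (ρ̂ : ℕ → ℕ → ℚ) → (α β : ℚ) → 0ℚ < α →
    Acceptable S ρ̂ → Acceptable S (affineWitness α β ρ̂)
proposition6p1 S ρ̂ α β 0<α = Acceptable-∘ S α {{pos⇒nonNeg α}}
  (affine-mono-< α β) (affine-boundedSublevels α β) (affine-lipschitz α β) ρ̂
  where
  instance
    α>0 : Positive α
    α>0 = positive 0<α
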